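{- For any quasielementary formula $E$ (in the restricted language described in the context), if $\mathbf{CL14}\vdash E$, then $\mathbf{CL14}$, and hence $\mathbf{CL13}$, proves $|\lfloor E\rfloor|$.
   Context: Formulas: built from nonlogical elementary atoms, general atoms, $\top,\bot$, $\neg$ (only on nonlogical atoms), connectives $\wedge,\vee,\curlywedge,\curlyvee,\vartriangle,\triangledown,\sqcap,\sqcup$ of arity $\ge2$; for compound $F$, $\neg F$ abbreviates the De Morgan dual ($\neg$ interchanges $\wedge/\vee$, $\curlywedge/\curlyvee$, $\vartriangle/\triangledown$, $\sqcap/\sqcup$, $\top/\bot$). Surface occurrence: in scope of no connective other than $\neg,\wedge,\vee$; semisurface: in scope of no $\sqcap,\sqcup$. Quasielementary: no general atoms, no operators other than $\neg,\top,\bot,\wedge,\vee,\curlywedge,\curlyvee$. $|F|$ (quasielementarization) replaces each sequential subformula by its first component, each $\sqcap$-subformula by $\top$, each $\sqcup$-subformula by $\bot$, and each occurrence of a general literal ($P$ or $\neg P$) by $\bot$. For quasielementary $F$, $\|F\|$ replaces each $\curlywedge$-subformula by $\top$, each $\curlyvee$-subformula by $\bot$; stable means $\|F\|$ is a classical tautology. $\mathbf{CL13}$ rules ($E_2\vartriangle\dots\vartriangle E_n$ means $E_2$ if $n=2$): ($\curlywedge$) $\vec H\mapsto F$, $F$ stable quasielementary, $\vec H$ all results of replacing a surface $E_1\curlywedge\dots\curlywedge E_n$ by some $E_i$; ($\curlyvee$) $H\mapsto F$, $F$ quasielementary, $H$ replaces a surface $E_1\curlyvee\dots\curlyvee E_n$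 by some $E_i$; ($\vartriangle\sqcap$) $|F|,\vec H\mapsto F$, $F$ not quasielementary, $\vec H$ all results of replacing a semisurface $E_1\sqcap\dots\sqcap E_n$ by some $E_i$ and of replacing a semisurface $E_1\vartriangle E_2\vartriangle\dots\vartriangle E_n$ by $E_2\vartriangle\dots\vartriangle E_n$; ($\sqcup$) $H\mapsto F$, $H$ replaces a semisurface $E_1\sqcup\dots\sqcup E_n$ by some $E_i$; ($\triangledown$) $H\mapsto F$, $H$ replaces a semisurface $E_1\triangledown E_2\triangledown\dots\triangledown E_n$ by $E_2\triangledown\dots\triangledown E_n$; (M) $H\mapsto F$, $H$ replaces one positive and one negative semisurface occurrence of a general atom $P$ by an elementary atom not occurring in $F$. $\mathbf{CL14}$ is the system for formulas without general atoms with the same rules except (M). Molecules: Fix a formula $F$; $\mathcal P$ = general atoms of $F$; $m$ = total number of occurrences of general atoms in $F$, or $2$ if this is less than 2. For $P\in\mathcal P$, $a,b\in\{1,\dots,m\}$ fix pairwise distinct elementary atoms $\check P^a_b$ not occurring in $F$; the language is restricted to the nonlogical atoms of $F$ and these $\check P^a_b$. Small molecules $\check P^a_b$; medium $\check P^a_{\sqcup}=\check P^a_1\sqcup\dots\sqcup\check P^a_m$; large $\check P^{\sqcap}_{\sqcup}=\check P^1_{\sqcup}\sqcap\dots\sqcap\check P^m_{\sqcup}$; all called $P$-based. A positive occurrence of molecule $M$ is an occurrence of $M$, a negative one is an occurrence of $\neg M$ (for small molecules, the literal $\neg\check P^a_b$ as a whole). An occurrence is independent if not part of a larger molecule. A small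 molecule is $E$-isolated if it has exactly one independent occurrence in $E$. The floorification $\lfloor E\rfloor$ is obtained from $E$ by replacing every positive (resp. negative) independent occurrence of every $P$-based large molecule, medium molecule and $E$-isolated small molecule (for every $P\in\mathcal P$) by the general literal $P$ (resp. $\neg P$). -}

module Defs where

open import Data.Nat using (ℕ; zero; suc; _+_; _∸_; _≡ᵇ_)
open import Data.Bool using (Bool; true; false; not; T; if_then_else_)
  renaming (_∧_ to _&&_; _∨_ to _||_)
open import Data.List using (List; []; _∷_; map; length; _++_; allFin)
open import Data.Bool.ListAction using (any)
open import Data.Fin using (Fin) renaming (zero to fz; suc to fs)
open import Data.Maybe using (Maybe; just; nothing; maybe)
open import Data.Product using (Σ; _×_; _,_)
open import Data.Sum using (_⊎_)
open import Data.List.Membership.Propositional using (_∈_; _∉_)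
open import Relation.Nullary using (¬_)
open import Relation.Binary.PropositionalEquality using (_≡_)

data Conn : Set where
  ∧ ∨ ⋏ ⋎ △ ▽ ⊓ ⊔ : Conn

-- Nonlogical elementary atoms and general atoms are both indexed by ℕ
-- (two disjoint name spaces).  ¬ is applied to nonlogical atoms only.
-- `op c E₁ E₂ [E₃ … Eₙ]` is E₁ c E₂ c … c Eₙ  (so n ≥ 2 structurally).
data Formula : Set where
  ⊤F ⊥F : Formula
  el ¬el : ℕ → Formula
  gen ¬gen : ℕ → Formula
  op : Conn → Formula → Formula → List Formula → Formula

dual : Conn → Conn
dual ∧ = ∨
dual ∨ = ∧
dual ⋏ = ⋎
dual ⋎ = ⋏
dual △ = ▽
dual ▽ = △
dual ⊓ = ⊔
dual ⊔ = ⊓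

mutual
  neg : Formula → Formula
  neg ⊤F = ⊥F
  neg ⊥F = ⊤F
  neg (el p) = ¬el p
  neg (¬el p) = el p
  neg (gen P) = ¬gen P
  neg (¬gen P) = gen P
  neg (op c a b cs) = op (dual c) (neg a) (neg b) (negL cs)

  negL : List Formula → List Formula
  negL [] = []
  negL (x ∷ xs) = neg x ∷ negL xs

mutual
  elAtoms : Formula → List ℕ
  elAtoms (el p) = p ∷ []
  elAtoms (¬el p) = p ∷ []
  elAtoms (op c a b cs) = elAtoms a ++ elAtoms b ++ elAtomsL cs
  elAtoms _ = []

  elAtomsL : List Formula → List ℕ
  elAtomsL [] = []
  elAtomsL (x ∷ xs) = elAtoms x ++ elAtomsL xs

mutual
  genOccs : Formula → List ℕ
  genOccs (gen P) = P ∷ []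
  genOccs (¬gen P) = P ∷ []
  genOccs (op c a b cs) = genOccs a ++ genOccs b ++ genOccsL cs
  genOccs _ = []

  genOccsL : List Formula → List ℕ
  genOccsL [] = []
  genOccsL (x ∷ xs) = genOccs x ++ genOccsL xs

NoGeneralAtoms : Formula → Set
NoGeneralAtoms F = genOccs F ≡ []

qeConn : Conn → Bool
qeConn ∧ = true
qeConn ∨ = true
qeConn ⋏ = true
qeConn ⋎ = true
qeConn _ = false

mutual
  isQE : Formula → Bool
  isQE (gen _) = false
  isQE (¬gen _) = false
  isQE (op c a b cs) = qeConn c && (isQE a && (isQE b && isQEL cs))
  isQE _ = true

  isQEL : List Formula → Bool
  isQEL [] = true
  isQEL (x ∷ xs) = isQE x && isQEL xs

Quasielementary : Formula → Set
Quasielementary F = T (isQE F)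

mutual
  qel : Formula → Formula
  qel (gen _) = ⊥F
  qel (¬gen _) = ⊥F
  qel (op △ a b cs) = qel a
  qel (op ▽ a b cs) = qel a
  qel (op ⊓ a b cs) = ⊤F
  qel (op ⊔ a b cs) = ⊥F
  qel (op c a b cs) = op c (qel a) (qel b) (qelL cs)
  qel F = F

  qelL : List Formula → List Formula
  qelL [] = []
  qelL (x ∷ xs) = qel x ∷ qelL xs

mutual
  nrm : Formula → Formula
  nrm (op ⋏ a b cs) = ⊤F
  nrm (op ⋎ a b cs) = ⊥F
  nrm (op c a b cs) = op c (nrm a) (nrm b) (nrmL cs)
  nrm F = F

  nrmL : List Formula → List Formula
  nrmL [] = []
  nrmL (x ∷ xs) = nrm x ∷ nrmL xs

conjunctive : Conn → Bool
conjunctive ∧ = true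
conjunctive ⋏ = true
conjunctive △ = true
conjunctive ⊓ = true
conjunctive _ = false

-- classical truth value under a valuation of elementary atoms.
-- (Only ⊤,⊥, literals, ∧, ∨ matter: ‖F‖ of a quasielementary F contains
--  nothing else.  Other clauses are irrelevant conventions.)
mutual
  eval : (ℕ → Bool) → Formula → Bool
  eval v ⊤F = true
  eval v ⊥F = false
  eval v (el p) = v p
  eval v (¬el p) = not (v p)
  eval v (gen _) = false
  eval v (¬gen _) = false
  eval v (op c a b cs) =
    if conjunctive c then (eval v a && (eval v b && evalAll v cs))
                     else (eval v a || (eval v b || evalAny v cs))

  evalAll : (ℕ → Bool) → List Formula → Bool
  evalAll v [] = true
  evalAll v (x ∷ xs) = eval v x && evalAll v xs

  evalAny : (ℕ → Bool) → List Formula → Bool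
  evalAny v [] = false
  evalAny v (x ∷ xs) = eval v x || evalAny v xs

ClassicalTautology : Formula → Set
ClassicalTautology G = ∀ (v : ℕ → Bool) → T (eval v G)

Stable : Formula → Set
Stable F = ClassicalTautology (nrm F)

-- surface: only in scope of ∧, ∨ (¬ only occurs on atoms)
surfaceConn : Conn → Bool
surfaceConn ∧ = true
surfaceConn ∨ = true
surfaceConn _ = false

semisurfaceConn : Conn → Bool
semisurfaceConn ⊓ = false
semisurfaceConn ⊔ = false
semisurfaceConn _ = true

mutual
  data At (ok : Conn → Bool) (R : Formula → Formula → Set) : Formula → Formula → Set where
    here : ∀ {X Y} → R X Y → At ok R X Y
    there : ∀ {c a b cs a' b' cs'} → T (ok c) →
            AtL ok R (a ∷ b ∷ cs) (a' ∷ b' ∷ cs') →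
            At ok R (op c a b cs) (op c a' b' cs')

  data AtL (ok : Conn → Bool) (R : Formula → Formula → Set) : List Formula → List Formula → Set where
    hd : ∀ {X Y xs} → At ok R X Y → AtL ok R (X ∷ xs) (Y ∷ xs)
    tl : ∀ {X xs ys} → AtL ok R xs ys → AtL ok R (X ∷ xs) (X ∷ ys)

data Pick (c : Conn) : Formula → Formula → Set where
  pick : ∀ {a b cs H} → H ∈ (a ∷ b ∷ cs) → Pick c (op c a b cs) H

data Behead (c : Conn) : Formula → Formula → Set where
  behead₂ : ∀ {a b} → Behead c (op c a b []) b
  beheadₙ : ∀ {a b d ds} → Behead c (op c a b (d ∷ ds)) (op c b d ds)

data System : Set where
  CL13 CL14 : System

data Deriv (sys : System) : Formula → Set where
  rule-⋏ : ∀ {F} → Quasielementary F → Stable F →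
           (∀ H → At surfaceConn (Pick ⋏) F H → Deriv sys H) → Deriv sys F
  rule-⋎ : ∀ {F H} → Quasielementary F → At surfaceConn (Pick ⋎) F H →
           Deriv sys H → Deriv sys F
  rule-△⊓ : ∀ {F} → ¬ Quasielementary F → Deriv sys (qel F) →
            (∀ H → At semisurfaceConn (Pick ⊓) F H → Deriv sys H) →
            (∀ H → At semisurfaceConn (Behead △) F H → Deriv sys H) →
            Deriv sys F
  rule-⊔ : ∀ {F H} → At semisurfaceConn (Pick ⊔) F H → Deriv sys H → Deriv sys F
  rule-▽ : ∀ {F H} → At semisurfaceConn (Behead ▽) F H → Deriv sys H → Deriv sys F
  rule-M : ∀ {F F' H} (P q : ℕ) → sys ≡ CL13 → q ∉ elAtoms F →
           At semisurfaceConn (λ X Y → X ≡ gen P × Y ≡ el q) F F' →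
           At semisurfaceConn (λ X Y → X ≡ ¬gen P × Y ≡ ¬el q) F' H →
           Deriv sys H → Deriv sys F

CL13⊢_ : Formula → Set
CL13⊢ F = Deriv CL13 F

-- CL14 is the system for formulas without general atoms
CL14⊢_ : Formula → Set
CL14⊢ F = NoGeneralAtoms F × Deriv CL14 F

-- m = number of occurrences of general atoms in F, or 2 if that is < 2;
-- written as 2 + k.
kOf : Formula → ℕ
kOf F = length (genOccs F) ∸ 2

mOf : Formula → ℕ
mOf F = 2 + kOf F

eqC : Conn → Conn → Bool
eqC ∧ ∧ = true
eqC ∨ ∨ = true
eqC ⋏ ⋏ = true
eqC ⋎ ⋎ = true
eqC △ △ = true
eqC ▽ ▽ = true
eqC ⊓ ⊓ = true
eqC ⊔ ⊔ = true
eqC _ _ = false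

mutual
  eqF : Formula → Formula → Bool
  eqF ⊤F ⊤F = true
  eqF ⊥F ⊥F = true
  eqF (el p) (el q) = p ≡ᵇ q
  eqF (¬el p) (¬el q) = p ≡ᵇ q
  eqF (gen p) (gen q) = p ≡ᵇ q
  eqF (¬gen p) (¬gen q) = p ≡ᵇ q
  eqF (op c a b cs) (op d a' b' ds) = eqC c d && (eqF a a' && (eqF b b' && eqL cs ds))
  eqF _ _ = false

  eqL : List Formula → List Formula → Bool
  eqL [] [] = true
  eqL (x ∷ xs) (y ∷ ys) = eqF x y && eqL xs ys
  eqL _ _ = false

-- Parameters: the fixed formula F and the atoms Č P a b (a, b ∈ Fin m,
-- where Fin index i stands for i+1).
module Molecules (F : Formula) (Č : ℕ → Fin (mOf F) → Fin (mOf F) → ℕ) where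

  𝒫 : List ℕ
  𝒫 = genOccs F

  k : ℕ
  k = kOf F

  bigOp : Conn → (Fin (mOf F) → Formula) → Formula
  bigOp c f = op c (f fz) (f (fs fz)) (map (λ i → f (fs (fs i))) (allFin k))

  small : ℕ → Fin (mOf F) → Fin (mOf F) → Formula
  small P a b = el (Č P a b)

  medium : ℕ → Fin (mOf F) → Formula
  medium P a = bigOp ⊔ (small P a)

  large : ℕ → Formula
  large P = bigOp ⊓ (medium P)

  anyP : (ℕ → Bool) → Bool
  anyP f = any f 𝒫

  anyFin : (Fin (mOf F) → Bool) → Bool
  anyFin f = any f (allFin (mOf F))

  posLM : ℕ → Formula → Bool
  posLM P G = eqF G (large P) || anyFin (λ a → eqF G (medium P a))

  negLM : ℕ → Formula → Bool
  negLM P G = eqF G (neg (large P)) || anyFin (λ a → eqF G (neg (medium P a)))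

  isLM : Formula → Bool
  isLM G = anyP (λ P → posLM P G || negLM P G)

  isČ : ℕ → ℕ → Bool
  isČ P x = anyFin (λ a → anyFin (λ b → Č P a b ≡ᵇ x))

  mutual
    indep : ℕ → Formula → ℕ
    indep x G = if isLM G then 0 else indep′ x G

    indep′ : ℕ → Formula → ℕ
    indep′ x (el y) = if x ≡ᵇ y then 1 else 0
    indep′ x (¬el y) = if x ≡ᵇ y then 1 else 0
    indep′ x (op c a b cs) = indep x a + (indep x b + indepL x cs)
    indep′ x _ = 0

    indepL : ℕ → List Formula → ℕ
    indepL x [] = 0
    indepL x (y ∷ ys) = indep x y + indepL x ys

  firstJust : List ℕ → (ℕ → Maybe Formula) → Maybe Formula
  firstJust [] f = nothing
  firstJust (P ∷ Ps) f = maybe just (firstJust Ps f) (f P)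

  module Floor (E : Formula) where

    isolated : ℕ → Bool
    isolated x = indep x E ≡ᵇ 1

    smallCase : ℕ → Formula → Maybe Formula
    smallCase P (el x) = if isČ P x && isolated x then just (gen P) else nothing
    smallCase P (¬el x) = if isČ P x && isolated x then just (¬gen P) else nothing
    smallCase P _ = nothing

    classifyP : ℕ → Formula → Maybe Formula
    classifyP P G =
      if posLM P G then just (gen P)
      else if negLM P G then just (¬gen P)
      else smallCase P G

    classify : Formula → Maybe Formula
    classify G = firstJust 𝒫 (λ P → classifyP P G)

    mutual
      flr : Formula → Formula
      flr G = maybe (λ R → R) (descend G) (classify G)

      descend : Formula → Formula
      descend (op c a b cs) = op c (flr a) (flr b) (flrL cs)
      descend G = G

      flrL : List Formula → List Formula
      flrL [] = []
      flrL (x ∷ xs) = flr x ∷ flrL xs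

  ⌊_⌋ : Formula → Formula
  ⌊ E ⌋ = Floor.flr E E

AdmissibleČ : (F : Formula) → (ℕ → Fin (mOf F) → Fin (mOf F) → ℕ) → Set
AdmissibleČ F Č =
  (∀ P P' a a' b b' → P ∈ genOccs F → P' ∈ genOccs F →
     Č P a b ≡ Č P' a' b' → (P ≡ P' × a ≡ a' × b ≡ b')) ×
  (∀ P a b → P ∈ genOccs F → Č P a b ∉ elAtoms F)

InLanguage : (F : Formula) → (ℕ → Fin (mOf F) → Fin (mOf F) → ℕ) → Formula → Set
InLanguage F Č E =
  (∀ q → q ∈ elAtoms E →
     q ∈ elAtoms F ⊎ Σ ℕ (λ P → Σ (Fin (mOf F)) (λ a → Σ (Fin (mOf F)) (λ b →
       P ∈ genOccs F × q ≡ Č P a b)))) ×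
  (∀ P → P ∈ genOccs E → P ∈ genOccs F)

-- A quasielementary E contains no ⊓ or ⊔, hence no large or medium
-- molecules, so ⌊E⌋ only turns the isolated small molecules of E into
-- general literals, which |·| then turns into ⊥.  Thus |⌊E⌋| is E with some
-- literals replaced by ⊥, each of them the only occurrence of its atom in E.
-- A CL14-proof of a quasielementary formula uses only the rules (⋏) and
-- (⋎), and doing the same replacement throughout it yields a proof again:
-- the premises are obtained by the same choices, and stability is preserved
-- because a valuation may give each such atom the value that makes its
-- single occurrence false.
module Submission where

open import Defs
open import Data.Nat using (ℕ; zero; suc; _+_; _≤_; _≡ᵇ_; z≤n; s≤s)
open import Data.Nat.Properties
  using (≤-trans; ≤-refl; ≤-reflexive; m≤m+n; m≤n+m; +-mono-≤; +-suc; +-identityʳ; ≡ᵇ⇒≡; +-commutativeSemigroup)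
open import Algebra.Properties.CommutativeSemigroup +-commutativeSemigroup using (interchange)
open import Data.Fin using (Fin)
open import Data.Bool using (Bool; true; false; not; T; if_then_else_)
  renaming (_∧_ to _&&_; _∨_ to _||_)
open import Data.Bool.Properties using (T-∧; T-≡)
open import Data.Bool.ListAction using (any)
open import Data.List using (List; []; _∷_; map; allFin)
open import Data.List.Relation.Unary.All as All using (All; []; _∷_)
open import Data.List.Relation.Unary.Any using (here; there; satisfied)
open import Data.List.Relation.Unary.Any.Properties using (any⁻)
open import Data.List.Membership.Propositional using (_∈_)
open import Data.List.Membership.Propositional.Properties using (∈-map⁺; ∈-map⁻)
open import Data.Maybe using (Maybe; just; nothing; maybe)
open import Data.Product using (Σ; _×_; _,_; proj₁; proj₂)
open import Function.Bundles using (Equivalence)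
open import Data.Empty using (⊥-elim)
open import Relation.Nullary using (¬_)
open import Relation.Binary.PropositionalEquality
  using (_≡_; refl; sym; trans; cong; cong₂; subst; module ≡-Reasoning)

open Equivalence using (to; from)

any-false : ∀ {A : Set} {f : A → Bool} xs → (∀ a → f a ≡ false) → any f xs ≡ false
any-false [] _ = refl
any-false (x ∷ xs) h rewrite h x = any-false xs h

op-cong : ∀ {c a a′ b b′ cs cs′} → a ≡ a′ → b ≡ b′ → cs ≡ cs′ → op c a b cs ≡ op c a′ b′ cs′
op-cong refl refl refl = refl

data QEConn : Conn → Set where
  qe-∧ : QEConn ∧
  qe-∨ : QEConn ∨
  qe-⋏ : QEConn ⋏
  qe-⋎ : QEConn ⋎

data QE : Formula → Set where
  ⊤ᵠ : QE ⊤F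
  ⊥ᵠ : QE ⊥F
  elᵠ : ∀ p → QE (el p)
  ¬elᵠ : ∀ p → QE (¬el p)
  opᵠ : ∀ {c a b cs} → QEConn c → All QE (a ∷ b ∷ cs) → QE (op c a b cs)

qeConn⇒QEConn : ∀ c → T (qeConn c) → QEConn c
qeConn⇒QEConn ∧ _ = qe-∧
qeConn⇒QEConn ∨ _ = qe-∨
qeConn⇒QEConn ⋏ _ = qe-⋏
qeConn⇒QEConn ⋎ _ = qe-⋎

QEConn⇒qeConn : ∀ {c} → QEConn c → T (qeConn c)
QEConn⇒qeConn qe-∧ = _
QEConn⇒qeConn qe-∨ = _
QEConn⇒qeConn qe-⋏ = _
QEConn⇒qeConn qe-⋎ = _

mutual
  isQE⇒QE : ∀ G → T (isQE G) → QE G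
  isQE⇒QE ⊤F _ = ⊤ᵠ
  isQE⇒QE ⊥F _ = ⊥ᵠ
  isQE⇒QE (el p) _ = elᵠ p
  isQE⇒QE (¬el p) _ = ¬elᵠ p
  isQE⇒QE (op c a b cs) q with to T-∧ q
  ... | qc , qabcs with to T-∧ qabcs
  ... | qa , qbcs with to T-∧ qbcs
  ... | qb , qcs = opᵠ (qeConn⇒QEConn c qc) (isQE⇒QE a qa ∷ isQE⇒QE b qb ∷ isQEL⇒All cs qcs)

  isQEL⇒All : ∀ xs → T (isQEL xs) → All QE xs
  isQEL⇒All [] _ = []
  isQEL⇒All (x ∷ xs) q = isQE⇒QE x (proj₁ (to T-∧ q)) ∷ isQEL⇒All xs (proj₂ (to T-∧ q))

mutual
  QE⇒isQE : ∀ {G} → QE G → T (isQE G)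
  QE⇒isQE ⊤ᵠ = _
  QE⇒isQE ⊥ᵠ = _
  QE⇒isQE (elᵠ p) = _
  QE⇒isQE (¬elᵠ p) = _
  QE⇒isQE (opᵠ qc qs) = from T-∧ (QEConn⇒qeConn qc , All⇒isQEL qs)

  All⇒isQEL : ∀ {xs} → All QE xs → T (isQEL xs)
  All⇒isQEL [] = _
  All⇒isQEL (q ∷ qs) = from T-∧ (QE⇒isQE q , All⇒isQEL qs)

mutual
  QE-pick : ∀ {ok c E H} → At ok (Pick c) E H → QE E → QE H
  QE-pick (here (pick m)) (opᵠ _ qs) = All.lookup qs m
  QE-pick (there _ l) (opᵠ qc qs) = opᵠ qc (QE-pickL l qs)

  QE-pickL : ∀ {ok c xs ys} → AtL ok (Pick c) xs ys → All QE xs → All QE ys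
  QE-pickL (hd a) (q ∷ qs) = QE-pick a q ∷ qs
  QE-pickL (tl l) (q ∷ qs) = q ∷ QE-pickL l qs

mutual
  ¬QE-at : ∀ {ok R E H} → (∀ {X Y} → R X Y → ¬ QE X) → At ok R E H → ¬ QE E
  ¬QE-at ¬R (here r) q = ¬R r q
  ¬QE-at ¬R (there _ l) (opᵠ _ qs) = ¬QE-atL ¬R l qs

  ¬QE-atL : ∀ {ok R xs ys} → (∀ {X Y} → R X Y → ¬ QE X) → AtL ok R xs ys → ¬ All QE xs
  ¬QE-atL ¬R (hd a) (q ∷ _) = ¬QE-at ¬R a q
  ¬QE-atL ¬R (tl l) (_ ∷ qs) = ¬QE-atL ¬R l qs

¬QE-pick-⊔ : ∀ {X Y} → Pick ⊔ X Y → ¬ QE X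
¬QE-pick-⊔ (pick _) (opᵠ () _)

¬QE-behead-▽ : ∀ {X Y} → Behead ▽ X Y → ¬ QE X
¬QE-behead-▽ behead₂ (opᵠ () _)
¬QE-behead-▽ beheadₙ (opᵠ () _)

CL14⇒CL13 : ∀ {G} → Deriv CL14 G → Deriv CL13 G
CL14⇒CL13 (rule-⋏ q st ds) = rule-⋏ q st (λ H a → CL14⇒CL13 (ds H a))
CL14⇒CL13 (rule-⋎ q a d) = rule-⋎ q a (CL14⇒CL13 d)
CL14⇒CL13 (rule-△⊓ nq d ds₁ ds₂) =
  rule-△⊓ nq (CL14⇒CL13 d) (λ H a → CL14⇒CL13 (ds₁ H a)) (λ H a → CL14⇒CL13 (ds₂ H a))
CL14⇒CL13 (rule-⊔ a d) = rule-⊔ a (CL14⇒CL13 d)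
CL14⇒CL13 (rule-▽ a d) = rule-▽ a (CL14⇒CL13 d)
CL14⇒CL13 (rule-M _ _ () _ _ _ _)

δ : ℕ → ℕ → ℕ
δ x y = if x ≡ᵇ y then 1 else 0

δ-diag : ∀ y → 1 ≤ δ y y
δ-diag zero = s≤s z≤n
δ-diag (suc y) = δ-diag y

-- polarity true counts the literal x, polarity false the literal ¬x
mutual
  occurrences : Bool → ℕ → Formula → ℕ
  occurrences b x (op c a a′ cs) = occurrences b x a + (occurrences b x a′ + occurrencesL b x cs)
  occurrences true x (el y) = δ x y
  occurrences false x (¬el y) = δ x y
  occurrences _ _ _ = 0

  occurrencesL : Bool → ℕ → List Formula → ℕ
  occurrencesL b x [] = 0
  occurrencesL b x (y ∷ ys) = occurrences b x y + occurrencesL b x ys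

occurrences± : ℕ → Formula → ℕ
occurrences± x G = occurrences true x G + occurrences false x G

occurrences-∈ : ∀ {b x H xs} → H ∈ xs → occurrences b x H ≤ occurrencesL b x xs
occurrences-∈ (here refl) = m≤m+n _ _
occurrences-∈ (there m) = ≤-trans (occurrences-∈ m) (m≤n+m _ _)

mutual
  occurrences-pick : ∀ {ok c b x E H} → At ok (Pick c) E H → occurrences b x H ≤ occurrences b x E
  occurrences-pick (here (pick m)) = occurrences-∈ m
  occurrences-pick (there _ l) = occurrences-pickL l

  occurrences-pickL : ∀ {ok c b x xs ys} → AtL ok (Pick c) xs ys → occurrencesL b x ys ≤ occurrencesL b x xs
  occurrences-pickL (hd a) = +-mono-≤ (occurrences-pick a) ≤-refl
  occurrences-pickL (tl l) = +-mono-≤ ≤-refl (occurrences-pickL l)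

occurrences±-pick : ∀ {ok c x E H} → At ok (Pick c) E H → occurrences± x H ≤ occurrences± x E
occurrences±-pick a = +-mono-≤ (occurrences-pick a) (occurrences-pick a)

nonzero : ℕ → Bool
nonzero zero = false
nonzero (suc _) = true

nonzero-≥1 : ∀ {b} → 1 ≤ b → nonzero b ≡ true
nonzero-≥1 {suc _} _ = refl

nonzero-+≤1 : ∀ {a b} → 1 ≤ a → a + b ≤ 1 → nonzero b ≡ false
nonzero-+≤1 {suc a} {zero} _ _ = refl
nonzero-+≤1 {suc a} {suc b} _ (s≤s a+1+b≤0) with subst (_≤ 0) (+-suc a b) a+1+b≤0
... | ()

module Falsify (dead : ℕ → Bool) where

  mutual
    falsify : Formula → Formula
    falsify (el y) = if dead y then ⊥F else el y
    falsify (¬el y) = if dead y then ⊥F else ¬el y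
    falsify (op c a b cs) = op c (falsify a) (falsify b) (falsifyL cs)
    falsify G = G

    falsifyL : List Formula → List Formula
    falsifyL [] = []
    falsifyL (x ∷ xs) = falsify x ∷ falsifyL xs

  falsifyL≡map : ∀ xs → falsifyL xs ≡ map falsify xs
  falsifyL≡map [] = refl
  falsifyL≡map (x ∷ xs) = cong (falsify x ∷_) (falsifyL≡map xs)

  mutual
    QE-falsify : ∀ {G} → QE G → QE (falsify G)
    QE-falsify ⊤ᵠ = ⊤ᵠ
    QE-falsify ⊥ᵠ = ⊥ᵠ
    QE-falsify (elᵠ y) with dead y
    ... | true = ⊥ᵠ
    ... | false = elᵠ y
    QE-falsify (¬elᵠ y) with dead y
    ... | true = ⊥ᵠ
    ... | false = ¬elᵠ y
    QE-falsify (opᵠ qc (qa ∷ qb ∷ qcs)) = opᵠ qc (QE-falsify qa ∷ QE-falsify qb ∷ QE-falsifyL qcs)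

    QE-falsifyL : ∀ {xs} → All QE xs → All QE (falsifyL xs)
    QE-falsifyL [] = []
    QE-falsifyL (q ∷ qs) = QE-falsify q ∷ QE-falsifyL qs

  mutual
    genOccs-falsify : ∀ G → genOccs (falsify G) ≡ genOccs G
    genOccs-falsify ⊤F = refl
    genOccs-falsify ⊥F = refl
    genOccs-falsify (el y) with dead y
    ... | true = refl
    ... | false = refl
    genOccs-falsify (¬el y) with dead y
    ... | true = refl
    ... | false = refl
    genOccs-falsify (gen _) = refl
    genOccs-falsify (¬gen _) = refl
    genOccs-falsify (op c a b cs) =
      cong₂ Data.List._++_ (genOccs-falsify a) (cong₂ Data.List._++_ (genOccs-falsify b) (genOccsL-falsifyL cs))

    genOccsL-falsifyL : ∀ xs → genOccsL (falsifyL xs) ≡ genOccsL xs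
    genOccsL-falsifyL [] = refl
    genOccsL-falsifyL (x ∷ xs) = cong₂ Data.List._++_ (genOccs-falsify x) (genOccsL-falsifyL xs)

  ∈-falsifyL⁺ : ∀ {H xs} → H ∈ xs → falsify H ∈ falsifyL xs
  ∈-falsifyL⁺ {xs = xs} m = subst (_ ∈_) (sym (falsifyL≡map xs)) (∈-map⁺ falsify m)

  ∈-falsifyL⁻ : ∀ {H′} xs → H′ ∈ falsifyL xs → Σ Formula λ H → H ∈ xs × H′ ≡ falsify H
  ∈-falsifyL⁻ xs m = ∈-map⁻ falsify (subst (_ ∈_) (falsifyL≡map xs) m)

  mutual
    At-falsify⁺ : ∀ {ok c E H} → At ok (Pick c) E H → At ok (Pick c) (falsify E) (falsify H)
    At-falsify⁺ (here (pick m)) = here (pick (∈-falsifyL⁺ m))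
    At-falsify⁺ (there o l) = there o (AtL-falsify⁺ l)

    AtL-falsify⁺ : ∀ {ok c xs ys} → AtL ok (Pick c) xs ys → AtL ok (Pick c) (falsifyL xs) (falsifyL ys)
    AtL-falsify⁺ (hd a) = hd (At-falsify⁺ a)
    AtL-falsify⁺ (tl l) = tl (AtL-falsify⁺ l)

  mutual
    At-falsify⁻ : ∀ {ok c H′} E → At ok (Pick c) (falsify E) H′ →
                  Σ Formula λ H → At ok (Pick c) E H × H′ ≡ falsify H
    At-falsify⁻ ⊤F (here ())
    At-falsify⁻ ⊥F (here ())
    At-falsify⁻ (gen _) (here ())
    At-falsify⁻ (¬gen _) (here ())
    At-falsify⁻ (el y) a with dead y
    At-falsify⁻ (el y) (here ()) | true
    At-falsify⁻ (el y) (here ()) | false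
    At-falsify⁻ (¬el y) a with dead y
    At-falsify⁻ (¬el y) (here ()) | true
    At-falsify⁻ (¬el y) (here ()) | false
    At-falsify⁻ (op d a b cs) (here (pick m)) with ∈-falsifyL⁻ (a ∷ b ∷ cs) m
    ... | H , m′ , eq = H , here (pick m′) , eq
    At-falsify⁻ (op d a b cs) (there o (hd l)) with At-falsify⁻ a l
    ... | a′ , l′ , refl = op d a′ b cs , there o (hd l′) , refl
    At-falsify⁻ (op d a b cs) (there o (tl (hd l))) with At-falsify⁻ b l
    ... | b′ , l′ , refl = op d a b′ cs , there o (tl (hd l′)) , refl
    At-falsify⁻ (op d a b cs) (there o (tl (tl l))) with AtL-falsify⁻ cs l
    ... | cs′ , l′ , refl = op d a b cs′ , there o (tl (tl l′)) , refl

    AtL-falsify⁻ : ∀ {ok c ys′} xs → AtL ok (Pick c) (falsifyL xs) ys′ →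
                   Σ (List Formula) λ ys → AtL ok (Pick c) xs ys × ys′ ≡ falsifyL ys
    AtL-falsify⁻ (x ∷ xs) (hd a) with At-falsify⁻ x a
    ... | H , a′ , refl = H ∷ xs , hd a′ , refl
    AtL-falsify⁻ (x ∷ xs) (tl l) with AtL-falsify⁻ xs l
    ... | ys , l′ , refl = x ∷ ys , tl l′ , refl

  record Falsifies (v v′ : ℕ → Bool) (o : Bool → ℕ → ℕ) : Set where
    field
      live : ∀ x → dead x ≡ false → v′ x ≡ v x
      falsifies⁺ : ∀ x → dead x ≡ true → 1 ≤ o true x → v′ x ≡ false
      falsifies⁻ : ∀ x → dead x ≡ true → 1 ≤ o false x → v′ x ≡ true

  module _ {v v′ : ℕ → Bool} where

    Falsifies-mono : ∀ {o o′} → (∀ b x → o b x ≤ o′ b x) → Falsifies v v′ o′ → Falsifies v v′ o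
    Falsifies-mono o≤o′ f = record
      { live = live
      ; falsifies⁺ = λ x d p → falsifies⁺ x d (≤-trans p (o≤o′ true x))
      ; falsifies⁻ = λ x d p → falsifies⁻ x d (≤-trans p (o≤o′ false x))
      }
      where open Falsifies f

    Falsifies-head : ∀ y ys → Falsifies v v′ (λ b x → occurrencesL b x (y ∷ ys)) →
                     Falsifies v v′ (λ b x → occurrences b x y)
    Falsifies-head y ys = Falsifies-mono λ b x → m≤m+n (occurrences b x y) (occurrencesL b x ys)

    Falsifies-tail : ∀ y ys → Falsifies v v′ (λ b x → occurrencesL b x (y ∷ ys)) →
                     Falsifies v v′ (λ b x → occurrencesL b x ys)
    Falsifies-tail y ys = Falsifies-mono λ b x → m≤n+m (occurrencesL b x ys) (occurrences b x y)

    record EvalAgree (xs ys : List Formula) : Set where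
      constructor _,_
      field
        all-agree : evalAll v′ xs ≡ evalAll v ys
        any-agree : evalAny v′ xs ≡ evalAny v ys

    EvalAgree-∷ : ∀ {x y xs ys} → eval v′ x ≡ eval v y → EvalAgree xs ys → EvalAgree (x ∷ xs) (y ∷ ys)
    EvalAgree-∷ p (all-agree , any-agree) = cong₂ _&&_ p all-agree , cong₂ _||_ p any-agree

    eval-op : ∀ c {a b cs a′ b′ cs′} → EvalAgree (a ∷ b ∷ cs) (a′ ∷ b′ ∷ cs′) →
              eval v′ (op c a b cs) ≡ eval v (op c a′ b′ cs′)
    eval-op c (all-agree , any-agree) with conjunctive c
    ... | true = all-agree
    ... | false = any-agree

    mutual
      eval-nrm-falsify : ∀ G → Falsifies v v′ (λ b x → occurrences b x G) →
                         eval v′ (nrm G) ≡ eval v (nrm (falsify G))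
      eval-nrm-falsify ⊤F f = refl
      eval-nrm-falsify ⊥F f = refl
      eval-nrm-falsify (gen _) f = refl
      eval-nrm-falsify (¬gen _) f = refl
      eval-nrm-falsify (el y) f with dead y in d
      ... | true = Falsifies.falsifies⁺ f y d (δ-diag y)
      ... | false = Falsifies.live f y d
      eval-nrm-falsify (¬el y) f with dead y in d
      ... | true = cong not (Falsifies.falsifies⁻ f y d (δ-diag y))
      ... | false = cong not (Falsifies.live f y d)
      eval-nrm-falsify (op ⋏ a b cs) f = refl
      eval-nrm-falsify (op ⋎ a b cs) f = refl
      eval-nrm-falsify (op ∧ a b cs) f = eval-op ∧ (evalAgree-operands a b cs f)
      eval-nrm-falsify (op ∨ a b cs) f = eval-op ∨ (evalAgree-operands a b cs f)
      eval-nrm-falsify (op △ a b cs) f = eval-op △ (evalAgree-operands a b cs f)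
      eval-nrm-falsify (op ▽ a b cs) f = eval-op ▽ (evalAgree-operands a b cs f)
      eval-nrm-falsify (op ⊓ a b cs) f = eval-op ⊓ (evalAgree-operands a b cs f)
      eval-nrm-falsify (op ⊔ a b cs) f = eval-op ⊔ (evalAgree-operands a b cs f)

      evalAgree-operands : ∀ a b cs → Falsifies v v′ (λ o x → occurrencesL o x (a ∷ b ∷ cs)) →
                           EvalAgree (nrmL (a ∷ b ∷ cs)) (nrmL (falsifyL (a ∷ b ∷ cs)))
      evalAgree-operands a b cs f =
        EvalAgree-∷ (eval-nrm-falsify a (Falsifies-head a (b ∷ cs) f))
          (EvalAgree-∷ (eval-nrm-falsify b (Falsifies-head b cs f′))
            (evalAgree-falsifyL cs (Falsifies-tail b cs f′)))
        where
          f′ : Falsifies v v′ (λ o x → occurrencesL o x (b ∷ cs))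
          f′ = Falsifies-tail a (b ∷ cs) f

      evalAgree-falsifyL : ∀ xs → Falsifies v v′ (λ o x → occurrencesL o x xs) →
                            EvalAgree (nrmL xs) (nrmL (falsifyL xs))
      evalAgree-falsifyL [] f = refl , refl
      evalAgree-falsifyL (x ∷ xs) f =
        EvalAgree-∷ (eval-nrm-falsify x (Falsifies-head x xs f)) (evalAgree-falsifyL xs (Falsifies-tail x xs f))

  DeadAtomsOnce : Formula → Set
  DeadAtomsOnce G = ∀ x → dead x ≡ true → occurrences± x G ≤ 1

  Stable-falsify : ∀ G → DeadAtomsOnce G → Stable G → Stable (falsify G)
  Stable-falsify G once stable v = subst T (eval-nrm-falsify G falsifies) (stable v′)
    where
      v′ : ℕ → Bool
      v′ x = if dead x then nonzero (occurrences false x G) else v x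

      v′-by-dead : ∀ x {d} → dead x ≡ d → v′ x ≡ (if d then nonzero (occurrences false x G) else v x)
      v′-by-dead x = cong (λ d → if d then nonzero (occurrences false x G) else v x)

      falsifies : Falsifies v v′ (λ b x → occurrences b x G)
      falsifies = record
        { live = λ x → v′-by-dead x
        ; falsifies⁺ = λ x d p → trans (v′-by-dead x d) (nonzero-+≤1 p (once x d))
        ; falsifies⁻ = λ x d p → trans (v′-by-dead x d) (nonzero-≥1 p)
        }

  DeadAtomsOnce-pick : ∀ {ok c E H} → At ok (Pick c) E H → DeadAtomsOnce E → DeadAtomsOnce H
  DeadAtomsOnce-pick a once x d = ≤-trans (occurrences±-pick a) (once x d)

  Deriv-falsify : ∀ {E} → Deriv CL14 E → QE E → DeadAtomsOnce E → Deriv CL14 (falsify E)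
  Deriv-falsify {E} (rule-⋏ _ stable premises) qe once =
    rule-⋏ (QE⇒isQE (QE-falsify qe)) (Stable-falsify E once stable) premises′
    where
      premises′ : ∀ H′ → At surfaceConn (Pick ⋏) (falsify E) H′ → Deriv CL14 H′
      premises′ H′ a with At-falsify⁻ E a
      ... | H , a′ , refl = Deriv-falsify (premises H a′) (QE-pick a′ qe) (DeadAtomsOnce-pick a′ once)
  Deriv-falsify (rule-⋎ _ a d) qe once =
    rule-⋎ (QE⇒isQE (QE-falsify qe)) (At-falsify⁺ a) (Deriv-falsify d (QE-pick a qe) (DeadAtomsOnce-pick a once))
  Deriv-falsify (rule-△⊓ ¬qe _ _ _) qe _ = ⊥-elim (¬qe (QE⇒isQE qe))
  Deriv-falsify (rule-⊔ a _) qe _ = ⊥-elim (¬QE-at ¬QE-pick-⊔ a qe)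
  Deriv-falsify (rule-▽ a _) qe _ = ⊥-elim (¬QE-at ¬QE-behead-▽ a qe)
  Deriv-falsify (rule-M _ _ () _ _ _ _)

eqF-QE : ∀ {G} → QE G → (∀ {a b cs} → eqF G (op ⊓ a b cs) ≡ false) × (∀ {a b cs} → eqF G (op ⊔ a b cs) ≡ false)
eqF-QE ⊤ᵠ = refl , refl
eqF-QE ⊥ᵠ = refl , refl
eqF-QE (elᵠ _) = refl , refl
eqF-QE (¬elᵠ _) = refl , refl
eqF-QE (opᵠ qe-∧ _) = refl , refl
eqF-QE (opᵠ qe-∨ _) = refl , refl
eqF-QE (opᵠ qe-⋏ _) = refl , refl
eqF-QE (opᵠ qe-⋎ _) = refl , refl

qel-op : ∀ {c a b cs} → QEConn c → qel (op c a b cs) ≡ op c (qel a) (qel b) (qelL cs)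
qel-op qe-∧ = refl
qel-op qe-∨ = refl
qel-op qe-⋏ = refl
qel-op qe-⋎ = refl

module _ (F : Formula) (Č : ℕ → Fin (mOf F) → Fin (mOf F) → ℕ) (E : Formula) where
  open Molecules F Č
  open Floor E

  isolatedSmall : ℕ → Bool
  isolatedSmall x = anyP (λ P → isČ P x && isolated x)

  open Falsify isolatedSmall

  posLM-QE : ∀ P {G} → QE G → posLM P G ≡ false
  posLM-QE P q = cong₂ _||_ (proj₁ (eqF-QE q)) (any-false (allFin (mOf F)) λ _ → proj₂ (eqF-QE q))

  negLM-QE : ∀ P {G} → QE G → negLM P G ≡ false
  negLM-QE P q = cong₂ _||_ (proj₂ (eqF-QE q)) (any-false (allFin (mOf F)) λ _ → proj₁ (eqF-QE q))

  isLM-QE : ∀ {G} → QE G → isLM G ≡ false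
  isLM-QE q = any-false 𝒫 λ P → cong₂ _||_ (posLM-QE P q) (negLM-QE P q)

  firstJust-cong : ∀ Ps {f g : ℕ → Maybe Formula} → (∀ P → f P ≡ g P) → firstJust Ps f ≡ firstJust Ps g
  firstJust-cong [] _ = refl
  firstJust-cong (P ∷ Ps) f≗g = cong₂ (maybe just) (firstJust-cong Ps f≗g) (f≗g P)

  firstJust-nothing : ∀ Ps → firstJust Ps (λ _ → nothing) ≡ nothing
  firstJust-nothing [] = refl
  firstJust-nothing (P ∷ Ps) = firstJust-nothing Ps

  qel-firstJust-guarded : ∀ Ps (g : ℕ → Bool) (literal : ℕ → Formula) d → (∀ P → qel (literal P) ≡ ⊥F) →
    qel (maybe (λ R → R) d (firstJust Ps λ P → if g P then just (literal P) else nothing))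
      ≡ (if any g Ps then ⊥F else qel d)
  qel-firstJust-guarded [] g literal d qel≡⊥ = refl
  qel-firstJust-guarded (P ∷ Ps) g literal d qel≡⊥ with g P
  ... | true = qel≡⊥ P
  ... | false = qel-firstJust-guarded Ps g literal d qel≡⊥

  classify-QE : ∀ {G} → QE G → classify G ≡ firstJust 𝒫 (λ P → smallCase P G)
  classify-QE {G} q = firstJust-cong 𝒫 λ P →
    cong₂ (λ p n → if p then just (gen P) else if n then just (¬gen P) else smallCase P G)
          (posLM-QE P q) (negLM-QE P q)

  flr-nonliteral : ∀ {G} → QE G → (∀ P → smallCase P G ≡ nothing) → flr G ≡ descend G
  flr-nonliteral {G} q noSmall =
    cong (maybe (λ R → R) (descend G))
         (trans (classify-QE q) (trans (firstJust-cong 𝒫 noSmall) (firstJust-nothing 𝒫)))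

  mutual
    qel-flr : ∀ {G} → QE G → qel (flr G) ≡ falsify G
    qel-flr ⊤ᵠ = cong qel (flr-nonliteral ⊤ᵠ λ _ → refl)
    qel-flr ⊥ᵠ = cong qel (flr-nonliteral ⊥ᵠ λ _ → refl)
    qel-flr (elᵠ y) =
      trans (cong (λ m → qel (maybe (λ R → R) (el y) m)) (classify-QE (elᵠ y)))
            (qel-firstJust-guarded 𝒫 (λ P → isČ P y && isolated y) gen (el y) λ _ → refl)
    qel-flr (¬elᵠ y) =
      trans (cong (λ m → qel (maybe (λ R → R) (¬el y) m)) (classify-QE (¬elᵠ y)))
            (qel-firstJust-guarded 𝒫 (λ P → isČ P y && isolated y) ¬gen (¬el y) λ _ → refl)
    qel-flr q@(opᵠ {c} {a} {b} {cs} qc (qa ∷ qb ∷ qcs)) = begin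
      qel (flr (op c a b cs))                           ≡⟨ cong qel (flr-nonliteral q λ _ → refl) ⟩
      qel (op c (flr a) (flr b) (flrL cs))              ≡⟨ qel-op qc ⟩
      op c (qel (flr a)) (qel (flr b)) (qelL (flrL cs)) ≡⟨ op-cong (qel-flr qa) (qel-flr qb) (qelL-flrL qcs) ⟩
      falsify (op c a b cs)                             ∎
      where open ≡-Reasoning

    qelL-flrL : ∀ {xs} → All QE xs → qelL (flrL xs) ≡ falsifyL xs
    qelL-flrL [] = refl
    qelL-flrL (q ∷ qs) = cong₂ _∷_ (qel-flr q) (qelL-flrL qs)

  mutual
    indep-QE : ∀ x {G} → QE G → indep x G ≡ occurrences± x G
    indep-QE x {G} q = trans (cong (λ b → if b then 0 else indep′ x G) (isLM-QE q)) (indep′-QE x q)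

    indep′-QE : ∀ x {G} → QE G → indep′ x G ≡ occurrences± x G
    indep′-QE x ⊤ᵠ = refl
    indep′-QE x ⊥ᵠ = refl
    indep′-QE x (elᵠ y) = sym (+-identityʳ (δ x y))
    indep′-QE x (¬elᵠ y) = refl
    indep′-QE x (opᵠ _ qs) = indepL-QE x qs

    indepL-QE : ∀ x {xs} → All QE xs → indepL x xs ≡ occurrencesL true x xs + occurrencesL false x xs
    indepL-QE x [] = refl
    indepL-QE x {y ∷ ys} (q ∷ qs) =
      trans (cong₂ _+_ (indep-QE x q) (indepL-QE x qs))
            (interchange (occurrences true x y) (occurrences false x y) (occurrencesL true x ys) (occurrencesL false x ys))

  isolatedSmall-once : QE E → DeadAtomsOnce E
  isolatedSmall-once q x d with satisfied (any⁻ _ 𝒫 (from T-≡ d))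
  ... | P , smallAndIsolated =
    ≤-reflexive (trans (sym (indep-QE x q)) (≡ᵇ⇒≡ (indep x E) 1 (proj₂ (to (T-∧ {isČ P x}) smallAndIsolated))))

lemma7p2 : (F : Formula) (Č : ℕ → Fin (mOf F) → Fin (mOf F) → ℕ) →
    AdmissibleČ F Č →
    (E : Formula) → InLanguage F Č E → Quasielementary E →
    CL14⊢ E →
    (CL14⊢ qel (Molecules.⌊_⌋ F Č E)) × (CL13⊢ qel (Molecules.⌊_⌋ F Č E))
lemma7p2 F Č _ E _ isQE-E (noGeneral , deriv) = (noGeneral′ , deriv′) , CL14⇒CL13 deriv′
  where
    open Falsify (isolatedSmall F Č E)

    qe : QE E
    qe = isQE⇒QE E isQE-E

    floor≡ : qel (Molecules.⌊_⌋ F Č E) ≡ falsify E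
    floor≡ = qel-flr F Č E qe

    deriv′ : Deriv CL14 (qel (Molecules.⌊_⌋ F Č E))
    deriv′ = subst (Deriv CL14) (sym floor≡) (Deriv-falsify deriv qe (isolatedSmall-once F Č E qe))

    noGeneral′ : NoGeneralAtoms (qel (Molecules.⌊_⌋ F Č E))
    noGeneral′ = subst NoGeneralAtoms (sym floor≡) (trans (genOccs-falsify E) noGeneral)
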